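{- Let $G$ and $H$ be finite undirected labeled graphs with edit cost functions, let $K\geq 2$ be an integer, and let $\pi$ be a node map between $G$ and $H$ with $(\epsilon,\epsilon)\notin\pi$. Let $\pi'$ be the node map returned by the algorithm K-REFINE started from $\pi$ with maximal swap size $K$ (described below, without adding the dummy assignment $(\epsilon,\epsilon)$ to the current node map). Then $S(\pi')\geq S(\pi)$, where for a node map $\sigma$, $S(\sigma)=|\{(u,v)\in\sigma\mid u\neq\epsilon,\ v\neq\epsilon\}|$ is the number of node substitutions in $\sigma$.
   Context: $\epsilon$ is a dummy symbol. A node map $\sigma$ between $G$ and $H$ is a set of assignments $(u,v)\in(V^G\cup\{\epsilon\})\times(V^H\cup\{\epsilon\})$ such that each node of $V^G$ and of $V^H$ appears in exactly one assignment; $c(P_\sigma)$ denotes the (real-valued) cost of the edit path induced by $\sigma$ (sum of node/edge substitution, deletion and insertion costs determined by $\sigma$). Swaps: order $\sigma$ as $((u_s,v_s))_{s=1}^{|\sigma|}$ and let $G_\sigma$ be the directed bipartite graph on vertices $u_1,\dots,u_{|\sigma|},v_1,\dots,v_{|\sigma|}$ (one per index, distinct even if some equal $\epsilon$) with forward arcs $(u_s,v_s)$ for all $s$ and backward arcs $(v_s,u_{s'})$ for all $s\neq s'$. For $K'\geq2$, a $K'$-swap is a directed cycle $C$ in $G_\sigma$ with exactly $K'$ forward arcs; $\mathcal{C}_{\sigma,K'}$ is the set of these. Let $F(C)=C\cap\sigma$, $B(C)=\{(u,v)\mid (v,u)\in C\setminus\sigma\}$, and $\mathrm{SWAP}(\sigma,C)=(\sigma\setminus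 F(C))\cup\{(u,v)\in B(C)\mid (u,v)\neq(\epsilon,\epsilon)\}$. Algorithm K-REFINE (input $G,H$, initial node map $\pi$, $K\geq2$): set $K'=2$. While $K'\leq K$: compute, over all $C\in\mathcal{C}_{\pi,K'}$, the value $\Delta(C)=c(P_{\mathrm{SWAP}(\pi,C)})-c(P_\pi)$, and let $C^\star$ be a swap with the smallest value $\Delta^\star$ among those with $\Delta(C)<0$ (if any). If such a $C^\star$ exists, replace $\pi$ by $\mathrm{SWAP}(\pi,C^\star)$ and reset $K'=2$; otherwise increase $K'$ by $1$. When the loop ends, return the current $\pi$ as $\pi'$. -}

module Defs where

open import Data.Nat using (ℕ; zero; suc; _≤_; _<ᵇ_)
open import Data.Fin using (Fin; zero; suc; toℕ)
import Data.Fin as Fin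
open import Data.Bool using (Bool; true; false; not; _∧_; _∨_; if_then_else_)
open import Data.Maybe using (Maybe; just; nothing)
open import Data.Product using (_×_; _,_; proj₁; proj₂)
open import Data.List using (List; []; _∷_; length; lookup; map; filterᵇ; tabulate; allFin; concatMap; foldr; _++_)
open import Data.Bool.ListAction using (any)
open import Relation.Binary.PropositionalEquality using (_≡_; _≢_)
open import Relation.Binary.Structures using (IsTotalOrder)
open import Algebra.Structures using (IsCommutativeMonoid)
open import Relation.Nullary using (¬_; does)
open import Function.Definitions using (Injective)

-- The paper uses real-valued costs; the standard library has
-- no reals, so we abstract over any totally ordered commutative monoid with
-- translation-monotone order (ℝ with + and ≤ is an instance).

record CostDomain : Set₁ where
  field
    C            : Set
    _≤C_         : C → C → Set
    _+C_         : C → C → C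
    0C           : C
    isTotalOrder : IsTotalOrder _≡_ _≤C_
    isCommMonoid : IsCommutativeMonoid _≡_ _+C_ 0C
    +-mono       : ∀ {x y} z → x ≤C y → (x +C z) ≤C (y +C z)

  _<C_ : C → C → Set
  x <C y = (x ≤C y) × (x ≢ y)

record LGraph (LV LE : Set) (n : ℕ) : Set where
  field
    label  : Fin n → LV
    edge   : Fin n → Fin n → Maybe LE
    sym    : ∀ i j → edge i j ≡ edge j i
    irrefl : ∀ i → edge i i ≡ nothing

record EditCosts (LV LE C : Set) : Set where
  field
    subV : LV → LV → C
    delV : LV → C
    insV : LV → C
    subE : LE → LE → C
    delE : LE → C
    insE : LE → C

-- Node maps.  ε is represented by nothing.  A node map is given as a list
-- of assignments (this list is the ordering ((u_s,v_s))_s used for swaps).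

Assignment : ℕ → ℕ → Set
Assignment n m = Maybe (Fin n) × Maybe (Fin m)

NodeMap : ℕ → ℕ → Set
NodeMap n m = List (Assignment n m)

eqMaybeFin : ∀ {n} → Fin n → Maybe (Fin n) → Bool
eqMaybeFin u (just u') = does (u Fin.≟ u')
eqMaybeFin u nothing   = false

countU : ∀ {n m} → Fin n → NodeMap n m → ℕ
countU u σ = length (filterᵇ (λ a → eqMaybeFin u (proj₁ a)) σ)

countV : ∀ {n m} → Fin m → NodeMap n m → ℕ
countV v σ = length (filterᵇ (λ a → eqMaybeFin v (proj₂ a)) σ)

record ValidNodeMap {n m} (σ : NodeMap n m) : Set where
  field
    coverG : ∀ (u : Fin n) → countU u σ ≡ 1
    coverH : ∀ (v : Fin m) → countV v σ ≡ 1

isSubst : ∀ {n m} → Assignment n m → Bool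
isSubst (just _ , just _) = true
isSubst _                 = false

isEpsEps : ∀ {n m} → Assignment n m → Bool
isEpsEps (nothing , nothing) = true
isEpsEps _                   = false

S : ∀ {n m} → NodeMap n m → ℕ
S σ = length (filterᵇ isSubst σ)

-- A (suc k)-swap in G_σ is a directed cycle
--   u_{s_0} → v_{s_0} → u_{s_1} → v_{s_1} → … → v_{s_k} → u_{s_0}
-- with pairwise distinct indices s_0,…,s_k; it is given by an injective
-- map idx : Fin (suc k) → indices of σ (the cyclic order being that of Fin).

-- cyclic successor on Fin (suc k)
next : ∀ {k} → Fin (suc k) → Fin (suc k)
next {zero}  zero = zero
next {suc k} zero = suc zero
next {suc k} (suc i) with next {k} i
... | zero  = zero
... | suc j = suc (suc j)

record Swap {n m} (σ : NodeMap n m) (k : ℕ) : Set where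
  field
    idx : Fin (suc k) → Fin (length σ)
    inj : Injective _≡_ _≡_ idx

-- forward arcs F(C) are the assignments at the indices idx i;
-- B(C) = { (u_{idx (next i)} , v_{idx i}) }.
SWAP : ∀ {n m} (σ : NodeMap n m) {k} → Swap σ k → NodeMap n m
SWAP σ {k} C = kept ++ filterᵇ (λ a → not (isEpsEps a)) new
  where
    open Swap C
    inF : Fin (length σ) → Bool
    inF s = any (λ i → does (idx i Fin.≟ s)) (allFin (suc k))
    kept : NodeMap _ _
    kept = map (lookup σ) (filterᵇ (λ s → not (inF s)) (allFin (length σ)))
    new : NodeMap _ _
    new = tabulate (λ i → proj₁ (lookup σ (idx (next i))) , proj₂ (lookup σ (idx i)))

module EditPath {LV LE : Set} (D : CostDomain) {n m : ℕ}
                (G : LGraph LV LE n) (H : LGraph LV LE m)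
                (c : EditCosts LV LE (CostDomain.C D)) where
  open CostDomain D
  open EditCosts c
  module G = LGraph G
  module H = LGraph H

  sumC : List C → C
  sumC = foldr _+C_ 0C

  imgG : NodeMap n m → Fin n → Maybe (Fin m)
  imgG []             u = nothing
  imgG ((a , b) ∷ σ)  u = if eqMaybeFin u a then b else imgG σ u

  imgH : NodeMap n m → Fin m → Maybe (Fin n)
  imgH []             v = nothing
  imgH ((a , b) ∷ σ)  v = if eqMaybeFin v b then a else imgH σ v

  nodeCost : Assignment n m → C
  nodeCost (just u  , just v)  = subV (G.label u) (H.label v)
  nodeCost (just u  , nothing) = delV (G.label u)
  nodeCost (nothing , just v)  = insV (H.label v)
  nodeCost (nothing , nothing) = 0C

  pairs : ∀ k → List (Fin k × Fin k)
  pairs k = concatMap (λ i → map (λ j → i , j)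
                         (filterᵇ (λ j → toℕ i <ᵇ toℕ j) (allFin k))) (allFin k)

  edgeCostG : NodeMap n m → Fin n × Fin n → C
  edgeCostG σ (i , j) with G.edge i j
  ... | nothing = 0C
  ... | just e with imgG σ i | imgG σ j
  ...   | just v | just v' with H.edge v v'
  ...     | just e' = subE e e'
  ...     | nothing = delE e
  edgeCostG σ (i , j) | just e | _ | _ = delE e

  edgeCostH : NodeMap n m → Fin m × Fin m → C
  edgeCostH σ (v , v') with H.edge v v'
  ... | nothing = 0C
  ... | just e' with imgH σ v | imgH σ v'
  ...   | just u | just u' with G.edge u u'
  ...     | just _  = 0C
  ...     | nothing = insE e'
  edgeCostH σ (v , v') | just e' | _ | _ = insE e'

  cost : NodeMap n m → C
  cost σ = sumC (map nodeCost σ)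
           +C (sumC (map (edgeCostG σ) (pairs n))
           +C sumC (map (edgeCostH σ) (pairs m)))

  -- Algorithm K-REFINE, as the relation "a run started with K' = suc k
  -- on the current map σ terminates with output π'".
  -- Δ(C) < 0  iff  cost (SWAP σ C) < cost σ ;
  -- Δ(C) ≤ Δ(C')  iff  cost (SWAP σ C) ≤ cost (SWAP σ C').

  Improving : ∀ (σ : NodeMap n m) {k} → Swap σ k → Set
  Improving σ C = cost (SWAP σ C) <C cost σ

  data Run (K : ℕ) : (k : ℕ) → NodeMap n m → NodeMap n m → Set where
    -- loop ends: K' = suc k > K
    stop    : ∀ {k σ} → K ≤ k → Run K k σ σ
    -- an improving swap of minimal Δ exists: apply it, reset K' = 2
    improve : ∀ {k σ π'} → suc k ≤ K → (C⋆ : Swap σ k) → Improving σ C⋆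
            → (∀ (C' : Swap σ k) → Improving σ C' → cost (SWAP σ C⋆) ≤C cost (SWAP σ C'))
            → Run K 1 (SWAP σ C⋆) π' → Run K k σ π'
    increase : ∀ {k σ π'} → suc k ≤ K → (∀ (C' : Swap σ k) → ¬ Improving σ C')
            → Run K (suc k) σ π' → Run K k σ π'

  KRefine : ℕ → NodeMap n m → NodeMap n m → Set
  KRefine K π π' = Run K 1 π π'

-- Position i
-- can lose a substitution only when u_{i+1} = ε, so summing
--   S(u_i , v_i) + [u_i = ε] ≤ S(u_{i+1} , v_i) + [u_{i+1} = ε]
-- over the cycle, where the two ε-counts agree by rotation, shows that no
-- swap decreases S.  The pointwise bound fails for (ε , ε), which is why the
-- hypothesis (ε , ε) ∉ π is needed; swaps preserve it since they filter
-- (ε , ε) out.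
module Submission where

open import Defs
open import Data.Nat using (ℕ; zero; suc; _+_; _≤_; z≤n)
open import Data.Nat.Properties
  using (≤-refl; ≤-trans; ≤-reflexive; +-mono-≤; +-monoʳ-≤; +-identityʳ; m≤m+n; +-cancelʳ-≤;
         +-0-commutativeMonoid; +-commutativeSemigroup; module ≤-Reasoning)
open import Algebra.Properties.CommutativeMonoid.Sum +-0-commutativeMonoid
  using (sum-syntax; ∑-distrib-+; sum-cong-≗; sum-replicate-zero)
open import Algebra.Properties.CommutativeSemigroup +-commutativeSemigroup
  using (x∙yz≈y∙xz)
open import Data.Bool using (Bool; true; false; not; _∧_; _∨_; if_then_else_; T?)
open import Data.Bool.ListAction using (any)
open import Data.Maybe using (just; nothing; is-nothing)
open import Data.Fin using (Fin; zero; suc; punchIn)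
open import Data.Fin.Properties using (_≟_)
open import Data.Product using (_,_; proj₁; proj₂)
open import Data.Sum using (inj₁; inj₂)
open import Data.List using (List; []; _∷_; _++_; length; lookup; map; filterᵇ; tabulate; allFin)
open import Data.List.Properties using (tabulate-lookup; length-++; filter-++)
open import Data.List.Membership.Propositional using (_∈_; _∉_)
open import Data.List.Membership.Propositional.Properties using (∈-lookup; ∈-map⁻; ∈-++⁻; ∈-filter⁻)
open import Function using (_∘_)
open import Relation.Nullary using (does; contradiction)
open import Relation.Binary.PropositionalEquality
  using (_≡_; _≢_; refl; sym; trans; cong; cong₂; subst; module ≡-Reasoning)

𝟙 : Bool → ℕ
𝟙 b = if b then 1 else 0

∑-mono-≤ : ∀ {N} {f g : Fin N → ℕ} → (∀ i → f i ≤ g i) → ∑[ i < N ] f i ≤ ∑[ i < N ] g i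
∑-mono-≤ {zero}  f≤g = z≤n
∑-mono-≤ {suc N} f≤g = +-mono-≤ (f≤g zero) (∑-mono-≤ (f≤g ∘ suc))

next-suc : ∀ {k} (j : Fin (suc k)) → next (suc j) ≡ punchIn (suc zero) (next j)
next-suc {k} j with next {k} j
... | zero  = refl
... | suc _ = refl

∑-next : ∀ k (f : Fin (suc k) → ℕ) → ∑[ i < suc k ] f (next i) ≡ ∑[ i < suc k ] f i
∑-next zero    f = refl
∑-next (suc k) f = begin
  f (suc zero) + ∑[ j < suc k ] f (next (suc j))
    ≡⟨ cong (f (suc zero) +_) (sum-cong-≗ (cong f ∘ next-suc)) ⟩
  f (suc zero) + ∑[ j < suc k ] f (punchIn (suc zero) (next j))
    ≡⟨ cong (f (suc zero) +_) (∑-next k (f ∘ punchIn (suc zero))) ⟩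
  f (suc zero) + (f zero + ∑[ j < k ] f (suc (suc j)))
    ≡⟨ x∙yz≈y∙xz (f (suc zero)) (f zero) _ ⟩
  f zero + (f (suc zero) + ∑[ j < k ] f (suc (suc j)))
    ∎
  where open ≡-Reasoning

∑-𝟙-≟ : ∀ {N} (y : Fin N) (p : Fin N → Bool) → ∑[ s < N ] 𝟙 (does (y ≟ s) ∧ p s) ≡ 𝟙 (p y)
∑-𝟙-≟ {suc N} zero    p = trans (cong (𝟙 (p zero) +_) (sum-replicate-zero N)) (+-identityʳ _)
∑-𝟙-≟ {suc N} (suc y) p = ∑-𝟙-≟ y (p ∘ suc)

length-filterᵇ-∷ : ∀ {A : Set} (p : A → Bool) x xs →
                   length (filterᵇ p (x ∷ xs)) ≡ 𝟙 (p x) + length (filterᵇ p xs)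
length-filterᵇ-∷ p x xs with p x
... | true  = refl
... | false = refl

length-filterᵇ-tabulate : ∀ {A : Set} {N} (p : A → Bool) (f : Fin N → A) →
                          length (filterᵇ p (tabulate f)) ≡ ∑[ i < N ] 𝟙 (p (f i))
length-filterᵇ-tabulate {N = zero}  p f = refl
length-filterᵇ-tabulate {N = suc N} p f =
  trans (length-filterᵇ-∷ p (f zero) _) (cong (𝟙 (p (f zero)) +_) (length-filterᵇ-tabulate p (f ∘ suc)))

length-filterᵇ-map : ∀ {A B : Set} (p : B → Bool) (f : A → B) xs →
                     length (filterᵇ p (map f xs)) ≡ length (filterᵇ (p ∘ f) xs)
length-filterᵇ-map p f []       = refl
length-filterᵇ-map p f (x ∷ xs) with p (f x)
... | true  = cong suc (length-filterᵇ-map p f xs)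
... | false = length-filterᵇ-map p f xs

length-filterᵇ-filterᵇ : ∀ {A : Set} (p q : A → Bool) xs →
  length (filterᵇ p (filterᵇ q xs)) ≡ length (filterᵇ (λ x → q x ∧ p x) xs)
length-filterᵇ-filterᵇ p q []       = refl
length-filterᵇ-filterᵇ p q (x ∷ xs) with q x
... | false = length-filterᵇ-filterᵇ p q xs
... | true with p x
...   | true  = cong suc (length-filterᵇ-filterᵇ p q xs)
...   | false = length-filterᵇ-filterᵇ p q xs

𝟙-∨-∧ : ∀ a b c → 𝟙 ((a ∨ b) ∧ c) ≤ 𝟙 (a ∧ c) + 𝟙 (b ∧ c)
𝟙-∨-∧ true  b c = m≤m+n _ _
𝟙-∨-∧ false b c = ≤-refl

𝟙-split : ∀ b c → 𝟙 c ≡ 𝟙 (not b ∧ c) + 𝟙 (b ∧ c)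
𝟙-split true  c = refl
𝟙-split false true  = refl
𝟙-split false false = refl

∑-any-≤ : ∀ {B : Set} {N} (e : B → Fin N) (p : Fin N → Bool) (l : List B) →
          ∑[ s < N ] 𝟙 (any (λ x → does (e x ≟ s)) l ∧ p s) ≤ length (filterᵇ (p ∘ e) l)
∑-any-≤ {N = N} e p [] = ≤-reflexive (sum-replicate-zero N)
∑-any-≤ {N = N} e p (x ∷ l) = begin
  ∑[ s < N ] 𝟙 ((does (e x ≟ s) ∨ inl s) ∧ p s)
    ≤⟨ ∑-mono-≤ (λ s → 𝟙-∨-∧ (does (e x ≟ s)) (inl s) (p s)) ⟩
  ∑[ s < N ] (𝟙 (does (e x ≟ s) ∧ p s) + 𝟙 (inl s ∧ p s))
    ≡⟨ ∑-distrib-+ (λ s → 𝟙 (does (e x ≟ s) ∧ p s)) (λ s → 𝟙 (inl s ∧ p s)) ⟩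
  ∑[ s < N ] 𝟙 (does (e x ≟ s) ∧ p s) + ∑[ s < N ] 𝟙 (inl s ∧ p s)
    ≤⟨ +-mono-≤ (≤-reflexive (∑-𝟙-≟ (e x) p)) (∑-any-≤ e p l) ⟩
  𝟙 (p (e x)) + length (filterᵇ (p ∘ e) l)
    ≡⟨ sym (length-filterᵇ-∷ (p ∘ e) x l) ⟩
  length (filterᵇ (p ∘ e) (x ∷ l))
    ∎
  where
  open ≤-Reasoning
  inl : Fin N → Bool
  inl s = any (λ x → does (e x ≟ s)) l

isSubst-rotate-≤ : ∀ {n m} (x y : Assignment n m) → (nothing , nothing) ≢ x →
  𝟙 (isSubst x) + 𝟙 (is-nothing (proj₁ x)) ≤ 𝟙 (isSubst (proj₁ y , proj₂ x)) + 𝟙 (is-nothing (proj₁ y))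
isSubst-rotate-≤ (just _  , just _)  (just _  , _) _ = ≤-refl
isSubst-rotate-≤ (just _  , just _)  (nothing , _) _ = ≤-refl
isSubst-rotate-≤ (just _  , nothing) _             _ = z≤n
isSubst-rotate-≤ (nothing , just _)  (just _  , _) _ = ≤-refl
isSubst-rotate-≤ (nothing , just _)  (nothing , _) _ = ≤-refl
isSubst-rotate-≤ (nothing , nothing) _             ε≢ε = contradiction refl ε≢ε

∑-isSubst-≤-rotated : ∀ {n m k} (x : Fin (suc k) → Assignment n m) → (∀ i → (nothing , nothing) ≢ x i) →
  ∑[ i < suc k ] 𝟙 (isSubst (x i)) ≤ ∑[ i < suc k ] 𝟙 (isSubst (proj₁ (x (next i)) , proj₂ (x i)))
∑-isSubst-≤-rotated {k = k} x ε≢x = +-cancelʳ-≤ (∑[ i < suc k ] ε (x i)) _ _ (begin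
  ∑[ i < suc k ] 𝟙 (isSubst (x i)) + ∑[ i < suc k ] ε (x i)
    ≡⟨ sym (∑-distrib-+ (𝟙 ∘ isSubst ∘ x) (ε ∘ x)) ⟩
  ∑[ i < suc k ] (𝟙 (isSubst (x i)) + ε (x i))
    ≤⟨ ∑-mono-≤ (λ i → isSubst-rotate-≤ (x i) (x (next i)) (ε≢x i)) ⟩
  ∑[ i < suc k ] (𝟙 (isSubst (rotated i)) + ε (x (next i)))
    ≡⟨ ∑-distrib-+ (𝟙 ∘ isSubst ∘ rotated) (ε ∘ x ∘ next) ⟩
  ∑[ i < suc k ] 𝟙 (isSubst (rotated i)) + ∑[ i < suc k ] ε (x (next i))
    ≡⟨ cong (∑[ i < suc k ] 𝟙 (isSubst (rotated i)) +_) (∑-next k (ε ∘ x)) ⟩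
  ∑[ i < suc k ] 𝟙 (isSubst (rotated i)) + ∑[ i < suc k ] ε (x i)
    ∎)
  where
  open ≤-Reasoning
  ε : Assignment _ _ → ℕ
  ε = 𝟙 ∘ is-nothing ∘ proj₁
  rotated : Fin (suc k) → Assignment _ _
  rotated i = proj₁ (x (next i)) , proj₂ (x i)

not-isEpsEps-∧-isSubst : ∀ {n m} (a : Assignment n m) → not (isEpsEps a) ∧ isSubst a ≡ isSubst a
not-isEpsEps-∧-isSubst (just _  , just _)  = refl
not-isEpsEps-∧-isSubst (just _  , nothing) = refl
not-isEpsEps-∧-isSubst (nothing , just _)  = refl
not-isEpsEps-∧-isSubst (nothing , nothing) = refl

module _ {n m} (σ : NodeMap n m) {k} (C : Swap σ k) where
  open Swap C

  -- inF, kept and new are those of the definition of SWAP, so that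
  -- SWAP σ C unfolds to kept ++ filterᵇ (not ∘ isEpsEps) (tabulate new).
  private
    N : ℕ
    N = length σ

    inF : Fin N → Bool
    inF s = any (λ i → does (idx i ≟ s)) (allFin (suc k))

    kept : NodeMap n m
    kept = map (lookup σ) (filterᵇ (not ∘ inF) (allFin N))

    new : Fin (suc k) → Assignment n m
    new i = proj₁ (lookup σ (idx (next i))) , proj₂ (lookup σ (idx i))

    subst? : Fin N → Bool
    subst? s = isSubst (lookup σ s)

    ∑kept : ℕ
    ∑kept = ∑[ s < N ] 𝟙 (not (inF s) ∧ subst? s)

    S-split : S σ ≡ ∑kept + ∑[ s < N ] 𝟙 (inF s ∧ subst? s)
    S-split = begin
      S σ
        ≡⟨ cong S (sym (tabulate-lookup σ)) ⟩
      S (tabulate (lookup σ))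
        ≡⟨ length-filterᵇ-tabulate isSubst (lookup σ) ⟩
      ∑[ s < N ] 𝟙 (subst? s)
        ≡⟨ sum-cong-≗ (λ s → 𝟙-split (inF s) (subst? s)) ⟩
      ∑[ s < N ] (𝟙 (not (inF s) ∧ subst? s) + 𝟙 (inF s ∧ subst? s))
        ≡⟨ ∑-distrib-+ (λ s → 𝟙 (not (inF s) ∧ subst? s)) (λ s → 𝟙 (inF s ∧ subst? s)) ⟩
      ∑kept + ∑[ s < N ] 𝟙 (inF s ∧ subst? s)
        ∎
      where open ≡-Reasoning

    S-kept : S kept ≡ ∑kept
    S-kept = begin
      S kept
        ≡⟨ length-filterᵇ-map isSubst (lookup σ) (filterᵇ (not ∘ inF) (allFin N)) ⟩
      length (filterᵇ subst? (filterᵇ (not ∘ inF) (allFin N)))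
        ≡⟨ length-filterᵇ-filterᵇ subst? (not ∘ inF) (allFin N) ⟩
      length (filterᵇ (λ s → not (inF s) ∧ subst? s) (allFin N))
        ≡⟨ length-filterᵇ-tabulate (λ s → not (inF s) ∧ subst? s) (λ s → s) ⟩
      ∑kept
        ∎
      where open ≡-Reasoning

    S-new : S (filterᵇ (not ∘ isEpsEps) (tabulate new)) ≡ ∑[ i < suc k ] 𝟙 (isSubst (new i))
    S-new = begin
      S (filterᵇ (not ∘ isEpsEps) (tabulate new))
        ≡⟨ length-filterᵇ-filterᵇ isSubst (not ∘ isEpsEps) (tabulate new) ⟩
      length (filterᵇ (λ a → not (isEpsEps a) ∧ isSubst a) (tabulate new))
        ≡⟨ length-filterᵇ-tabulate (λ a → not (isEpsEps a) ∧ isSubst a) new ⟩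
      ∑[ i < suc k ] 𝟙 (not (isEpsEps (new i)) ∧ isSubst (new i))
        ≡⟨ sum-cong-≗ (cong 𝟙 ∘ not-isEpsEps-∧-isSubst ∘ new) ⟩
      ∑[ i < suc k ] 𝟙 (isSubst (new i))
        ∎
      where open ≡-Reasoning

    S-SWAP : S (SWAP σ C) ≡ ∑kept + ∑[ i < suc k ] 𝟙 (isSubst (new i))
    S-SWAP = begin
      S (kept ++ filterᵇ (not ∘ isEpsEps) (tabulate new))
        ≡⟨ cong length (filter-++ (T? ∘ isSubst) kept _) ⟩
      length (filterᵇ isSubst kept ++ filterᵇ isSubst (filterᵇ (not ∘ isEpsEps) (tabulate new)))
        ≡⟨ length-++ (filterᵇ isSubst kept) ⟩
      S kept + S (filterᵇ (not ∘ isEpsEps) (tabulate new))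
        ≡⟨ cong₂ _+_ S-kept S-new ⟩
      ∑kept + ∑[ i < suc k ] 𝟙 (isSubst (new i))
        ∎
      where open ≡-Reasoning

  S≤S-SWAP : (nothing , nothing) ∉ σ → S σ ≤ S (SWAP σ C)
  S≤S-SWAP ε∉σ = begin
    S σ
      ≡⟨ S-split ⟩
    ∑kept + ∑[ s < N ] 𝟙 (inF s ∧ subst? s)
      ≤⟨ +-monoʳ-≤ ∑kept (∑-any-≤ idx subst? (allFin (suc k))) ⟩
    ∑kept + length (filterᵇ (subst? ∘ idx) (allFin (suc k)))
      ≡⟨ cong (∑kept +_) (length-filterᵇ-tabulate (subst? ∘ idx) (λ i → i)) ⟩
    ∑kept + ∑[ i < suc k ] 𝟙 (subst? (idx i))
      ≤⟨ +-monoʳ-≤ ∑kept (∑-isSubst-≤-rotated (lookup σ ∘ idx) ε≢forward) ⟩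
    ∑kept + ∑[ i < suc k ] 𝟙 (isSubst (new i))
      ≡⟨ sym S-SWAP ⟩
    S (SWAP σ C)
      ∎
    where
    open ≤-Reasoning
    ε≢forward : ∀ i → (nothing , nothing) ≢ lookup σ (idx i)
    ε≢forward i ε≡x = ε∉σ (subst (_∈ σ) (sym ε≡x) (∈-lookup (idx i)))

  ∉-SWAP : (nothing , nothing) ∉ σ → (nothing , nothing) ∉ SWAP σ C
  ∉-SWAP ε∉σ ε∈ with ∈-++⁻ kept ε∈
  ... | inj₁ ε∈kept with ∈-map⁻ (lookup σ) ε∈kept
  ...   | s , _ , ε≡σs = ε∉σ (subst (_∈ σ) (sym ε≡σs) (∈-lookup s))
  ∉-SWAP ε∉σ ε∈ | inj₂ ε∈new with ∈-filter⁻ (T? ∘ not ∘ isEpsEps) {xs = tabulate new} ε∈new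
  ... | _ , ()

module _ {LV LE : Set} (D : CostDomain) {n m : ℕ} (G : LGraph LV LE n) (H : LGraph LV LE m)
         (c : EditCosts LV LE (CostDomain.C D)) where
  open EditPath D G H c using (Run; stop; improve; increase)

  S≤S-Run : ∀ {K k σ π'} → Run K k σ π' → (nothing , nothing) ∉ σ → S σ ≤ S π'
  S≤S-Run (stop _)                      ε∉σ = ≤-refl
  S≤S-Run {σ = σ} (improve _ C _ _ run) ε∉σ =
    ≤-trans (S≤S-SWAP σ C ε∉σ) (S≤S-Run run (∉-SWAP σ C ε∉σ))
  S≤S-Run (increase _ _ run)            ε∉σ = S≤S-Run run ε∉σ

proposition3 : ∀ {LV LE : Set} (D : CostDomain) {n m : ℕ}
                 (G : LGraph LV LE n) (H : LGraph LV LE m)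
                 (c : EditCosts LV LE (CostDomain.C D))
                 (K : ℕ) → 2 ≤ K
                 → (π : NodeMap n m) → ValidNodeMap π → (nothing , nothing) ∉ π
                 → (π' : NodeMap n m) → EditPath.KRefine D G H c K π π'
                 → S π ≤ S π'
proposition3 D G H c K _ π _ ε∉π π' run = S≤S-Run D G H c run ε∉π
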